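{- Let $G\leq\mathrm{Sym}(\Omega)$ be a finite transitive permutation group and let $K$ be the subgroup of $G$ fixing (setwise) every block of the system of imprimitivity $\{\omega^{\mathrm{Fix}(G)}:\omega\in\Omega\}$, i.e. $K=\bigcap_{\omega\in\Omega}G_{\{\omega^{\mathrm{Fix}(G)}\}}$. Then $K=\mathrm{Fix}(G)$.
   Context: $\mathrm{Fix}(G):=\left\langle \bigcup_{\omega\in\Omega} G_\omega\right\rangle$ is the subgroup generated by all point-stabilizers. For a subgroup $H$ and $\omega\in\Omega$, $\omega^H$ denotes the orbit of $\omega$ under $H$; for $S\subseteq\Omega$, $G_{\{S\}}$ denotes the setwise stabilizer of $S$ in $G$. -}

module Defs where

open import Data.Nat using (ℕ)
open import Data.Fin using (Fin)
open import Data.Fin.Permutation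
  using (Permutation′; _⟨$⟩ʳ_; id; flip; _∘ₚ_; _≈_)
open import Data.Product using (Σ; _×_; ∃)
open import Function.Bundles using (_⇔_)
open import Relation.Binary.PropositionalEquality using (_≡_)

-- Ω = Fin n; Sym(Ω) = Permutation′ n.  A subset of Sym(Ω) is a predicate.
Pred : ℕ → Set₁
Pred n = Permutation′ n → Set

-- A subgroup of Sym(Ω): closed under identity, composition, inverses,
-- and (since permutations are records of functions) under pointwise equality.
record IsSubgroup {n : ℕ} (G : Pred n) : Set where
  field
    resp : ∀ {σ τ} → σ ≈ τ → G σ → G τ
    one  : G id
    mul  : ∀ {σ τ} → G σ → G τ → G (σ ∘ₚ τ)
    inv  : ∀ {σ} → G σ → G (flip σ)

Transitive : {n : ℕ} → Pred n → Set
Transitive {n} G = ∀ (α β : Fin n) → ∃ λ g → G g × (g ⟨$⟩ʳ α ≡ β)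

Stab : {n : ℕ} → Pred n → Fin n → Pred n
Stab G ω g = G g × (g ⟨$⟩ʳ ω ≡ ω)

data Fix {n : ℕ} (G : Pred n) : Pred n where
  gen  : ∀ {σ} (ω : Fin n) → Stab G ω σ → Fix G σ
  one  : Fix G id
  mul  : ∀ {σ τ} → Fix G σ → Fix G τ → Fix G (σ ∘ₚ τ)
  inv  : ∀ {σ} → Fix G σ → Fix G (flip σ)
  resp : ∀ {σ τ} → σ ≈ τ → Fix G σ → Fix G τ

Orbit : {n : ℕ} → Pred n → Fin n → Fin n → Set
Orbit H ω α = ∃ λ h → H h × (h ⟨$⟩ʳ ω ≡ α)

SetStab : {n : ℕ} → Pred n → (Fin n → Set) → Pred n
SetStab {n} G S g = G g × (∀ (α : Fin n) → S α ⇔ S (g ⟨$⟩ʳ α))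

K : {n : ℕ} → Pred n → Pred n
K {n} G g = ∀ (ω : Fin n) → SetStab G (Orbit (Fix G) ω) g

-- Every element of Fix(G) preserves its own Fix(G)-orbits, so Fix(G) ≤ K.
-- Conversely, if g ∈ K then g maps ω into ω^{Fix(G)}, say gω = hω with
-- h ∈ Fix(G); then g h⁻¹ fixes ω, so g = (g h⁻¹) h ∈ G_ω Fix(G) ⊆ Fix(G)
-- (products read left to right, as in _∘ₚ_).
module Submission where

open import Defs
open import Data.Nat using (ℕ; zero; suc)
open import Data.Fin using (zero)
open import Data.Fin.Permutation
  using (Permutation′; _⟨$⟩ʳ_; _⟨$⟩ˡ_; id; flip; _∘ₚ_; inverseˡ; inverseʳ)
open import Data.Product using (_,_)
open import Function.Bundles using (_⇔_; mk⇔; Equivalence)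
open import Relation.Binary.PropositionalEquality
  using (_≡_; refl; sym; trans; cong)

module _ {n : ℕ} {G : Pred n} where

  Fix-isSubgroup : IsSubgroup (Fix G)
  Fix-isSubgroup = record { resp = resp ; one = one ; mul = mul ; inv = inv }

  Fix⊆G : IsSubgroup G → ∀ {g} → Fix G g → G g
  Fix⊆G sg (gen ω (g∈G , _)) = g∈G
  Fix⊆G sg one               = IsSubgroup.one sg
  Fix⊆G sg (mul a b)         = IsSubgroup.mul sg (Fix⊆G sg a) (Fix⊆G sg b)
  Fix⊆G sg (inv a)           = IsSubgroup.inv sg (Fix⊆G sg a)
  Fix⊆G sg (resp e a)        = IsSubgroup.resp sg e (Fix⊆G sg a)

orbit-stable : ∀ {n} {H : Pred n} → IsSubgroup H → ∀ {g} → H g →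
               ∀ ω → SetStab H (Orbit H ω) g
orbit-stable {H = H} sg {g} g∈H ω = g∈H , λ α → mk⇔ forward backward
  where
  forward : ∀ {α} → Orbit H ω α → Orbit H ω (g ⟨$⟩ʳ α)
  forward (h , h∈H , hω≡α) =
    h ∘ₚ g , IsSubgroup.mul sg h∈H g∈H , cong (g ⟨$⟩ʳ_) hω≡α
  backward : ∀ {α} → Orbit H ω (g ⟨$⟩ʳ α) → Orbit H ω α
  backward (h , h∈H , hω≡gα) =
    h ∘ₚ flip g , IsSubgroup.mul sg h∈H (IsSubgroup.inv sg g∈H) ,
    trans (cong (g ⟨$⟩ˡ_) hω≡gα) (inverseˡ g)

Fix⊆K : ∀ {n} {G : Pred n} → IsSubgroup G → ∀ {g} → Fix G g → K G g
Fix⊆K sg g∈Fix ω with orbit-stable Fix-isSubgroup g∈Fix ω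
... | _ , preservesOrbit = Fix⊆G sg g∈Fix , preservesOrbit

Stab∙Fix⊆Fix : ∀ {n} {G : Pred n} → IsSubgroup G → ∀ {g} ω →
               G g → Orbit (Fix G) ω (g ⟨$⟩ʳ ω) → Fix G g
Stab∙Fix⊆Fix {G = G} sg {g} ω g∈G (h , h∈Fix , hω≡gω) =
  resp (λ _ → inverseʳ h) (mul (gen ω (gh⁻¹∈G , gh⁻¹ω≡ω)) h∈Fix)
  where
  gh⁻¹∈G : G (g ∘ₚ flip h)
  gh⁻¹∈G = IsSubgroup.mul sg g∈G (IsSubgroup.inv sg (Fix⊆G sg h∈Fix))
  gh⁻¹ω≡ω : (g ∘ₚ flip h) ⟨$⟩ʳ ω ≡ ω
  gh⁻¹ω≡ω = trans (cong (h ⟨$⟩ˡ_) (sym hω≡gω)) (inverseˡ h)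

K⊆Fix : ∀ {n} {G : Pred n} → IsSubgroup G → ∀ {g} → K G g → Fix G g
K⊆Fix {zero}  sg g∈K = resp (λ ()) one
K⊆Fix {suc n} sg g∈K with g∈K zero
... | g∈G , preservesOrbit =
  Stab∙Fix⊆Fix sg zero g∈G
    (Equivalence.to (preservesOrbit zero) (id , one , refl))

corollary2p8 : (n : ℕ) (G : Pred n) → IsSubgroup G → Transitive G →
    (g : Permutation′ n) → K G g ⇔ Fix G g
corollary2p8 n G sg _ g = mk⇔ (K⊆Fix sg) (Fix⊆K sg)
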